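{- Let $p_0,p_1,p_2$ be positive integers with $\gcd(p_0,p_1,p_2)=1$, and put $n=p_0+p_1+p_2$. Let $E=(\mathbb{Z}/n\mathbb{Z})\times\{0,1,2\}$, and let $\sigma_0,\sigma_1$ be the permutations of $E$ defined for $m\in\mathbb{Z}/n\mathbb{Z}$ by $$\sigma_0(m,0)=(m,1),\quad \sigma_0(m,1)=(m,2),\quad \sigma_0(m,2)=(m,0),$$ $$\sigma_1(m,0)=(m-p_1,2),\quad \sigma_1(m,1)=(m-p_2,0),\quad \sigma_1(m,2)=(m-p_0,1).$$ Then the permutations $\sigma_0\sigma_1$ and $\sigma_1\sigma_0$ commute.
   Context: Composition of permutations is as functions: $(\sigma\tau)(x)=\sigma(\tau(x))$. These permutations describe the monodromy of the dessin d'enfant on the billiards surface of the rational triangle with angles $\frac{p_0\pi}{n},\frac{p_1\pi}{n},\frac{p_2\pi}{n}$. -}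

module Defs where

open import Data.Nat using (ℕ; suc; _+_; _*_; _∸_; NonZero)
open import Data.Nat.DivMod using (_mod_)
open import Data.Fin using (Fin; zero; suc; toℕ)
open import Data.Product using (_×_; _,_)

-- ℤ/nℤ is modelled by Fin n (n ≥ 1).
-- Subtraction m - p in ℤ/nℤ, for m : Fin n and p : ℕ:
-- the residue of (m + n * p ∸ p) mod n, which equals m - p mod n
-- since n * p ≥ p for n ≥ 1.
subMod : (n : ℕ) .{{_ : NonZero n}} → Fin n → ℕ → Fin n
subMod n m p = (toℕ m + n * p ∸ p) mod n

E : (n : ℕ) → Set
E n = Fin n × Fin 3

σ₀ : (n : ℕ) → E n → E n
σ₀ n (m , zero) = (m , suc zero)
σ₀ n (m , suc zero) = (m , suc (suc zero))
σ₀ n (m , suc (suc zero)) = (m , zero)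

σ₁ : (n : ℕ) .{{_ : NonZero n}} → (p₀ p₁ p₂ : ℕ) → E n → E n
σ₁ n p₀ p₁ p₂ (m , zero) = (subMod n m p₁ , suc (suc zero))
σ₁ n p₀ p₁ p₂ (m , suc zero) = (subMod n m p₂ , zero)
σ₁ n p₀ p₁ p₂ (m , suc (suc zero)) = (subMod n m p₀ , suc zero)

-- Composition as functions: (σ τ)(x) = σ (τ x).

{-# OPTIONS --safe #-}
module Submission where

-- Every dart keeps its colour under σ₀σ₁ and under σ₁σ₀, and on each colour both act on
-- ℤ/nℤ as a translation (by -(p_i + p_j) for two of the p's). Translations of ℤ/nℤ commute,
-- so the two maps commute.

open import Defs
open import Data.Nat using (ℕ; _+_; _*_; _∸_; _%_; NonZero; _>_)
open import Data.Nat.DivMod using (%-distribˡ-+; m%n%n≡m%n)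
open import Data.Nat.GCD using (gcd)
open import Data.Nat.Properties using (+-∸-assoc; m≤n*m; +-assoc; +-comm)
open import Data.Fin using (Fin; zero; suc; toℕ)
open import Data.Fin.Properties using (toℕ-injective; toℕ-fromℕ<)
open import Data.Product using (_,_)
open import Relation.Binary.PropositionalEquality using (_≡_; cong; sym; module ≡-Reasoning)

[m%n+k]%n≡[m+k]%n : ∀ m k n .{{_ : NonZero n}} → (m % n + k) % n ≡ (m + k) % n
[m%n+k]%n≡[m+k]%n m k n = begin
  (m % n + k) % n          ≡⟨ %-distribˡ-+ (m % n) k n ⟩
  (m % n % n + k % n) % n  ≡⟨ cong (λ v → (v + k % n) % n) (m%n%n≡m%n m n) ⟩
  (m % n + k % n) % n      ≡⟨ sym (%-distribˡ-+ m k n) ⟩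
  (m + k) % n              ∎
  where open ≡-Reasoning

module _ (n : ℕ) .{{_ : NonZero n}} where

  shift : ℕ → ℕ
  shift p = n * p ∸ p

  toℕ-subMod : ∀ (m : Fin n) p → toℕ (subMod n m p) ≡ (toℕ m + shift p) % n
  toℕ-subMod m p = begin
    toℕ (subMod n m p)        ≡⟨ toℕ-fromℕ< _ ⟩
    (toℕ m + n * p ∸ p) % n   ≡⟨ cong (_% n) (+-∸-assoc (toℕ m) (m≤n*m p n)) ⟩
    (toℕ m + shift p) % n     ∎
    where open ≡-Reasoning

  toℕ-subMod-subMod : ∀ (m : Fin n) p q →
                      toℕ (subMod n (subMod n m p) q) ≡ (toℕ m + (shift p + shift q)) % n
  toℕ-subMod-subMod m p q = begin
    toℕ (subMod n (subMod n m p) q)           ≡⟨ toℕ-subMod (subMod n m p) q ⟩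
    (toℕ (subMod n m p) + shift q) % n        ≡⟨ cong (λ v → (v + shift q) % n) (toℕ-subMod m p) ⟩
    ((toℕ m + shift p) % n + shift q) % n     ≡⟨ [m%n+k]%n≡[m+k]%n (toℕ m + shift p) (shift q) n ⟩
    (toℕ m + shift p + shift q) % n           ≡⟨ cong (_% n) (+-assoc (toℕ m) (shift p) (shift q)) ⟩
    (toℕ m + (shift p + shift q)) % n         ∎
    where open ≡-Reasoning

  subMod-comm : ∀ (m : Fin n) p q → subMod n (subMod n m p) q ≡ subMod n (subMod n m q) p
  subMod-comm m p q = toℕ-injective (begin
    toℕ (subMod n (subMod n m p) q)     ≡⟨ toℕ-subMod-subMod m p q ⟩
    (toℕ m + (shift p + shift q)) % n   ≡⟨ cong (λ v → (toℕ m + v) % n) (+-comm (shift p) (shift q)) ⟩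
    (toℕ m + (shift q + shift p)) % n   ≡⟨ sym (toℕ-subMod-subMod m q p) ⟩
    toℕ (subMod n (subMod n m q) p)     ∎)
    where open ≡-Reasoning

lemma1 : (p₀ p₁ p₂ : ℕ) → p₀ > 0 → p₁ > 0 → p₂ > 0 →
         gcd (gcd p₀ p₁) p₂ ≡ 1 →
         (n : ℕ) .{{_ : NonZero n}} → n ≡ p₀ + p₁ + p₂ →
         ∀ (x : E n) →
         σ₀ n (σ₁ n p₀ p₁ p₂ (σ₁ n p₀ p₁ p₂ (σ₀ n x)))
           ≡ σ₁ n p₀ p₁ p₂ (σ₀ n (σ₀ n (σ₁ n p₀ p₁ p₂ x)))
lemma1 p₀ p₁ p₂ _ _ _ _ n _ (m , zero)           = cong (_, zero) (subMod-comm n m p₂ p₁)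
lemma1 p₀ p₁ p₂ _ _ _ _ n _ (m , suc zero)       = cong (_, suc zero) (subMod-comm n m p₀ p₂)
lemma1 p₀ p₁ p₂ _ _ _ _ n _ (m , suc (suc zero)) = cong (_, suc (suc zero)) (subMod-comm n m p₁ p₀)
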